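{- Let $m\in V$. (i) If $m\equiv 2\pmod 4$ or $m\equiv 4\pmod 8$, then $m<N_3(m)<2m$ and $2m<N_2(m)<4m$. (ii) There exist infinitely many $m\in V$ such that $N_2(m)/N_3(m)=2$. Further, if $m\equiv 2\pmod 4$, then $2\le N_2(m)/N_3(m)\le 3$. (iii) Each of $N_2$ and $N_3$ contains an infinite geometric progression.
   Context: $\phi$ is Euler's totient function, $V=\phi(\mathbb{N})$, $\phi^{ -1}(m)=\{x\in\mathbb{N}\colon\phi(x)=m\}$. For $m\in V$: $N_2(m)=\max\phi^{ -1}(m)$, $N_3(m)=\min\phi^{ -1}(m)$, and $N_i=\{N_i(m)\colon m\in V\}$ for $i=2,3$. -}

module Defs where

open import Data.Nat using (ℕ; zero; suc; _+_; _*_; _≤_; _<_; _≥_)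
open import Data.Nat.GCD using (gcd)
open import Data.Nat.Properties using (_≟_)
open import Data.List using (List; length; filter; upTo; map)
open import Data.Product using (Σ; ∃; _×_)
open import Relation.Binary.PropositionalEquality using (_≡_)

φ : ℕ → ℕ
φ n = length (filter (λ k → gcd k n ≟ 1) (map suc (upTo n)))

InV : ℕ → Set
InV m = ∃ λ x → 1 ≤ x × φ x ≡ m

IsN₂ : ℕ → ℕ → Set
IsN₂ m x = 1 ≤ x × φ x ≡ m × (∀ y → 1 ≤ y → φ y ≡ m → y ≤ x)

IsN₃ : ℕ → ℕ → Set
IsN₃ m x = 1 ≤ x × φ x ≡ m × (∀ y → 1 ≤ y → φ y ≡ m → x ≤ y)

InN₂ : ℕ → Set
InN₂ x = ∃ λ m → InV m × IsN₂ m x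

InN₃ : ℕ → Set
InN₃ x = ∃ λ m → InV m × IsN₃ m x

-- φ is computed by counting residues, which gives φ(pn) = pφ(n) for p ∣ n and φ(pn) = (p − 1)φ(n)
-- for p ∤ n, hence φ(p^(a+1)w) = p^a(p − 1)φ(w). Every odd prime factor of n contributes a
-- factor 2 to φ(n), so if 8 ∤ m = φ(x) then m has an odd preimage z with at most two prime
-- factors, and z/φ(z) ≤ (3/2)(5/4) < 2. Thus m < N₃(m) ≤ z < 2m and 2m < 2z ≤ N₂(m) < 4m, the
-- last bound because every preimage y of m has y/φ(y) ≤ 2 · 15/8 < 4. If moreover 4 ∤ m, then
-- y/φ(y) ≤ 3 and N₂(m) ≤ 3m < 3N₃(m). For m = 2·3^(3+4j) the number m + 1 is divisible by 5,
-- and the only preimages of m are 3^(4+4j) and 2·3^(4+4j); this gives infinitely many m with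
-- N₂(m) = 2N₃(m) and the progressions 81·81^j ⊆ N₃, 162·81^j ⊆ N₂.

module Submission where

open import Data.Bool.Base using (Bool; true; false; _∧_; not)
open import Data.Bool.Properties using (∧-comm)
open import Data.List.Base using ([]; _∷_; length; filter; map; upTo; applyUpTo)
open import Data.List.Properties using (map-upTo)
open import Data.List.Relation.Unary.All using ([]; _∷_)
open import Data.Nat.Base
open import Data.Nat.Coprimality as Coprime using (Coprime; coprime?; coprime-+; coprime-divisor; coprime⇒gcd≡1; gcd≡1⇒coprime)
open import Data.Nat.Divisibility
open import Data.Nat.DivMod using (m%n≤m)
open import Data.Nat.GCD using (gcd)
open import Data.Nat.Induction using (<-rec)
open import Data.Nat.ListAction using (product)
open import Data.Nat.Primality
open import Data.Nat.Primality.Factorisation using (factorise)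
open import Data.Nat.Properties
open import Data.Nat.Tactic.RingSolver using (solve-∀)
open import Data.Product.Base using (∃; ∃₂; _×_; _,_; proj₁)
open import Data.Sum.Base using (_⊎_; inj₁; inj₂)
open import Function.Base using (_∘_)
open import Function.Bundles using (_⇔_; mk⇔; Equivalence)
open import Relation.Nullary.Decidable using (yes; no; does; dec-true; dec-false; does-⇔; ¬?; _×-dec_; from-yes; from-no)
open import Relation.Nullary.Negation using (¬_; contradiction)
open import Relation.Unary using (Decidable)
open import Relation.Binary.PropositionalEquality
open import Defs
open import Algebra.Properties.CommutativeSemigroup +-commutativeSemigroup using () renaming (interchange to +-interchange)

-- Counting

fromBool : Bool → ℕ
fromBool true = 1
fromBool false = 0

count : (ℕ → Bool) → ℕ → ℕ
count f zero = 0
count f (suc n) = fromBool (f 0) + count (f ∘ suc) n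

length-filter-applyUpTo : ∀ {P : ℕ → Set} (P? : Decidable P) g n →
  length (filter P? (applyUpTo g n)) ≡ count (λ k → does (P? (g k))) n
length-filter-applyUpTo P? g zero = refl
length-filter-applyUpTo P? g (suc n) with does (P? (g 0))
... | true = cong suc (length-filter-applyUpTo P? (g ∘ suc) n)
... | false = length-filter-applyUpTo P? (g ∘ suc) n

count-cong : ∀ {f g} n → (∀ k → f k ≡ g k) → count f n ≡ count g n
count-cong zero f≗g = refl
count-cong (suc n) f≗g = cong₂ _+_ (cong fromBool (f≗g 0)) (count-cong n (f≗g ∘ suc))

count-+ : ∀ f m n → count f (m + n) ≡ count f m + count (f ∘ (m +_)) n
count-+ f zero n = refl
count-+ f (suc m) n = trans (cong (fromBool (f 0) +_) (count-+ (f ∘ suc) m n))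
                            (sym (+-assoc (fromBool (f 0)) _ _))

count-≤ : ∀ f n → count f n ≤ n
count-≤ f zero = z≤n
count-≤ f (suc n) with f 0
... | true = s≤s (count-≤ (f ∘ suc) n)
... | false = m≤n⇒m≤1+n (count-≤ (f ∘ suc) n)

count-none : ∀ {f} n → (∀ k → k < n → f k ≡ false) → count f n ≡ 0
count-none zero none = refl
count-none (suc n) none rewrite none 0 z<s = count-none n (λ k k<n → none (suc k) (s<s k<n))

fromBool-split : ∀ a b → fromBool a ≡ fromBool (a ∧ b) + fromBool (a ∧ not b)
fromBool-split true true = refl
fromBool-split true false = refl
fromBool-split false b = refl

count-split : ∀ f g n → count f n ≡ count (λ k → f k ∧ g k) n + count (λ k → f k ∧ not (g k)) n
count-split f g zero = refl
count-split f g (suc n) = trans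
  (cong₂ _+_ (fromBool-split (f 0) (g 0)) (count-split (f ∘ suc) (g ∘ suc) n))
  (+-interchange (fromBool (f 0 ∧ g 0)) _ _ _)

count-periodic : ∀ f n → (∀ k → f (n + k) ≡ f k) → ∀ i → count f (i * n) ≡ i * count f n
count-periodic f n periodic zero = refl
count-periodic f n periodic (suc i) = begin
    count f (n + i * n)
  ≡⟨ count-+ f n (i * n) ⟩
    count f n + count (f ∘ (n +_)) (i * n)
  ≡⟨ cong (count f n +_) (count-cong (i * n) periodic) ⟩
    count f n + count f (i * n)
  ≡⟨ cong (count f n +_) (count-periodic f n periodic i) ⟩
    count f n + i * count f n ∎
  where open ≡-Reasoning

count-last : ∀ f n → count f (suc n) ≡ count f n + fromBool (f n)
count-last f n = begin
    count f (suc n)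
  ≡⟨ cong (count f) (+-comm 1 n) ⟩
    count f (n + 1)
  ≡⟨ count-+ f n 1 ⟩
    count f n + (fromBool (f (n + 0)) + 0)
  ≡⟨ cong (count f n +_) (trans (+-identityʳ _) (cong (fromBool ∘ f) (+-identityʳ n))) ⟩
    count f n + fromBool (f n) ∎
  where open ≡-Reasoning

module _ (q : ℕ) where
  private
    d = suc q

  onMultiples : (ℕ → Bool) → ℕ → Bool
  onMultiples g k = does (d ∣? suc k) ∧ g (suc k)

  count-onMultiples-block : ∀ g → count (onMultiples g) d ≡ fromBool (g d)
  count-onMultiples-block g = begin
      count (onMultiples g) (suc q)
    ≡⟨ count-last (onMultiples g) q ⟩
      count (onMultiples g) q + fromBool (onMultiples g q)
    ≡⟨ cong₂ _+_ (count-none q below) (cong (λ b → fromBool (b ∧ g d)) (dec-true (d ∣? d) ∣-refl)) ⟩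
      fromBool (g d) ∎
    where
    open ≡-Reasoning
    below : ∀ k → k < q → onMultiples g k ≡ false
    below k k<q = cong (_∧ g (suc k)) (dec-false (d ∣? suc k) (>⇒∤ (s<s k<q)))

  onMultiples-shift : ∀ g k → onMultiples g (d + k) ≡ onMultiples (g ∘ (d +_)) k
  onMultiples-shift g k = cong₂ _∧_
    (does-⇔ (mk⇔ (λ d∣ → ∣m+n∣m⇒∣n (subst (d ∣_) (sym (+-suc d k)) d∣) ∣-refl)
                 (subst (d ∣_) (+-suc d k) ∘ ∣m∣n⇒∣m+n ∣-refl))
            (d ∣? suc (d + k)) (d ∣? suc k))
    (cong g (sym (+-suc d k)))

  count-onMultiples : ∀ g N → count (onMultiples g) (d * N) ≡ count (λ j → g (d * suc j)) N
  count-onMultiples g zero = cong (count (onMultiples g)) (*-zeroʳ q)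
  count-onMultiples g (suc N) = begin
      count (onMultiples g) (d * suc N)
    ≡⟨ cong (count (onMultiples g)) (*-suc d N) ⟩
      count (onMultiples g) (d + d * N)
    ≡⟨ count-+ (onMultiples g) d (d * N) ⟩
      count (onMultiples g) d + count (onMultiples g ∘ (d +_)) (d * N)
    ≡⟨ cong₂ _+_ (count-onMultiples-block g) (count-cong (d * N) (onMultiples-shift g)) ⟩
      fromBool (g d) + count (onMultiples (g ∘ (d +_))) (d * N)
    ≡⟨ cong₂ _+_ (cong (fromBool ∘ g) (sym (*-identityʳ d))) (count-onMultiples (g ∘ (d +_)) N) ⟩
      fromBool (g (d * 1)) + count (λ j → g (d + d * suc j)) N
    ≡⟨ cong (fromBool (g (d * 1)) +_) (count-cong N (λ j → cong g (sym (*-suc d (suc j))))) ⟩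
      count (λ j → g (d * suc j)) (suc N) ∎
    where open ≡-Reasoning

-- Primes and parity

prime⇒2≤ : ∀ {p} → Prime p → 2 ≤ p
prime⇒2≤ {p} pp = nonTrivial⇒n>1 p {{prime⇒nonTrivial pp}}

prime∤1 : ∀ {p} → Prime p → p ∤ 1
prime∤1 pp p∣1 = ¬prime[1] (subst Prime (∣1⇒≡1 p∣1) pp)

prime∣prime⇒≡ : ∀ {q p} → Prime q → Prime p → q ∣ p → q ≡ p
prime∣prime⇒≡ qq pp q∣p with prime⇒irreducible pp q∣p
... | inj₁ refl = contradiction qq ¬prime[1]
... | inj₂ q≡p = q≡p

prime∣^⇒∣ : ∀ {q m} n → Prime q → q ∣ m ^ n → q ∣ m
prime∣^⇒∣ zero qq q∣1 = contradiction q∣1 (prime∤1 qq)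
prime∣^⇒∣ {q} {m} (suc n) qq q∣m^[1+n] with euclidsLemma m (m ^ n) qq q∣m^[1+n]
... | inj₁ q∣m = q∣m
... | inj₂ q∣m^n = prime∣^⇒∣ n qq q∣m^n

prime-divisor : ∀ {n} → 2 ≤ n → ∃ λ p → Prime p × p ∣ n
prime-divisor {n} 2≤n with factorise n {{>-nonZero (<-trans z<s 2≤n)}}
... | record { factors = [] ; isFactorisation = n≡1 } = contradiction (subst (2 ≤_) n≡1 2≤n) λ { (s≤s ()) }
... | record { factors = p ∷ ps ; isFactorisation = n≡p*ps ; factorsPrime = pp ∷ _ } =
  p , pp , divides (product ps) (trans n≡p*ps (*-comm p (product ps)))

p-adic-split : ∀ {p} → 2 ≤ p → ∀ {n} → 1 ≤ n → ∃₂ λ e w → n ≡ p ^ e * w × p ∤ w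
p-adic-split {p} 2≤p {n} = <-rec (λ n → 1 ≤ n → ∃₂ λ e w → n ≡ p ^ e * w × p ∤ w) step n
  where
  step : ∀ n → (∀ {m} → m < n → 1 ≤ m → ∃₂ λ e w → m ≡ p ^ e * w × p ∤ w) →
         1 ≤ n → ∃₂ λ e w → n ≡ p ^ e * w × p ∤ w
  step n rec 1≤n with p ∣? n
  ... | no p∤n = 0 , n , sym (*-identityˡ n) , p∤n
  ... | yes (divides q n≡q*p) with q
  ...   | zero = contradiction (subst (1 ≤_) n≡q*p 1≤n) λ ()
  ...   | suc r with rec (subst (suc r <_) (sym n≡q*p) (m<m*n (suc r) p 2≤p)) (s≤s z≤n)
  ...     | e , w , q≡p^e*w , p∤w = suc e , w , trans n≡q*p (trans (cong (_* p) q≡p^e*w) (rearrange (p ^ e) w p)) , p∤w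
    where
    rearrange : ∀ x w p → x * w * p ≡ p * x * w
    rearrange = solve-∀

2∣n⊎2∣1+n : ∀ n → 2 ∣ n ⊎ 2 ∣ suc n
2∣n⊎2∣1+n zero = inj₁ (divides 0 refl)
2∣n⊎2∣1+n (suc n) with 2∣n⊎2∣1+n n
... | inj₁ (divides q n≡q*2) = inj₂ (divides (suc q) (cong (suc ∘ suc) n≡q*2))
... | inj₂ 2∣1+n = inj₁ 2∣1+n

odd⇒2∣pred : ∀ {n} → 2 ∤ n → 2 ∣ n ∸ 1
odd⇒2∣pred {zero} 2∤n = contradiction (divides 0 refl) 2∤n
odd⇒2∣pred {suc n} 2∤1+n with 2∣n⊎2∣1+n n
... | inj₁ 2∣n = 2∣n
... | inj₂ 2∣1+n = contradiction 2∣1+n 2∤1+n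

odd⇒1≤ : ∀ {n} → 2 ∤ n → 1 ≤ n
odd⇒1≤ {zero} 2∤0 = contradiction (divides 0 refl) 2∤0
odd⇒1≤ {suc n} _ = s≤s z≤n

odd-* : ∀ {m n} → 2 ∤ m → 2 ∤ n → 2 ∤ m * n
odd-* {m} {n} 2∤m 2∤n 2∣mn with euclidsLemma m n prime[2] 2∣mn
... | inj₁ 2∣m = 2∤m 2∣m
... | inj₂ 2∣n = 2∤n 2∣n

odd-^ : ∀ {m} → 2 ∤ m → ∀ n → 2 ∤ m ^ n
odd-^ 2∤m n 2∣m^n = 2∤m (prime∣^⇒∣ n prime[2] 2∣m^n)

odd-prime⇒3≤ : ∀ {p} → Prime p → 2 ∤ p → 3 ≤ p
odd-prime⇒3≤ {p} pp 2∤p with prime⇒2≤ pp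
... | s≤s (s≤s {n = zero} z≤n) = contradiction ∣-refl 2∤p
... | s≤s (s≤s {n = suc _} z≤n) = s≤s (s≤s (s≤s z≤n))

odd-prime≢3⇒5≤ : ∀ {p} → Prime p → 2 ∤ p → p ≢ 3 → 5 ≤ p
odd-prime≢3⇒5≤ {p} pp 2∤p p≢3 with odd-prime⇒3≤ pp 2∤p
... | s≤s (s≤s (s≤s {n = zero} z≤n)) = contradiction refl p≢3
... | s≤s (s≤s (s≤s {n = suc zero} z≤n)) = contradiction (divides 2 refl) 2∤p
... | s≤s (s≤s (s≤s {n = suc (suc _)} z≤n)) = s≤s (s≤s (s≤s (s≤s (s≤s z≤n))))

prime[3] : Prime 3
prime[3] = from-yes (prime? 3)

prime[7] : Prime 7
prime[7] = from-yes (prime? 7)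

2∤3^ : ∀ n → 2 ∤ 3 ^ n
2∤3^ = odd-^ (from-no (2 ∣? 3))

1≤3^ : ∀ K → 1 ≤ 3 ^ K
1≤3^ K = odd⇒1≤ (2∤3^ K)

-- Coprimality

coprime-*⇔ : ∀ {k m n} → Coprime k (m * n) ⇔ (Coprime k m × Coprime k n)
coprime-*⇔ {k} {m} {n} = mk⇔ split join
  where
  split : Coprime k (m * n) → Coprime k m × Coprime k n
  split c = (λ (d∣k , d∣m) → c (d∣k , ∣m⇒∣m*n n d∣m)) , (λ (d∣k , d∣n) → c (d∣k , ∣n⇒∣m*n m d∣n))
  join : Coprime k m × Coprime k n → Coprime k (m * n)
  join (ckm , ckn) {d} (d∣k , d∣mn) = ckn (d∣k , coprime-divisor cdm d∣mn)
    where
    cdm : Coprime d m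
    cdm (e∣d , e∣m) = ckm (∣-trans e∣d d∣k , e∣m)

coprime-prime⇔∤ : ∀ {k p} → Prime p → Coprime k p ⇔ p ∤ k
coprime-prime⇔∤ {k} {p} pp = mk⇔ to from
  where
  to : Coprime k p → p ∤ k
  to c p∣k = nonTrivial⇒≢1 {{prime⇒nonTrivial pp}} (c (p∣k , ∣-refl))
  from : p ∤ k → Coprime k p
  from p∤k (d∣k , d∣p) with prime⇒irreducible pp d∣p
  ... | inj₁ d≡1 = d≡1
  ... | inj₂ refl = contradiction d∣k p∤k

coprime-+ˡ⇔ : ∀ {n j} → Coprime (n + j) n ⇔ Coprime j n
coprime-+ˡ⇔ = mk⇔ (λ c {_} (d∣j , d∣n) → c (∣m∣n⇒∣m+n d∣n d∣j , d∣n)) coprime-+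

coprime-*ˡ⇔ : ∀ {p j n} → Prime p → p ∤ n → Coprime (p * j) n ⇔ Coprime j n
coprime-*ˡ⇔ {p} {j} {n} pp p∤n = mk⇔ to from
  where
  to : Coprime (p * j) n → Coprime j n
  to c (d∣j , d∣n) = c (∣n⇒∣m*n p d∣j , d∣n)
  from : Coprime j n → Coprime (p * j) n
  from c = Coprime.sym (Equivalence.from coprime-*⇔ (Equivalence.from (coprime-prime⇔∤ pp) p∤n , Coprime.sym c))

coprime-*-prime⇔ : ∀ {k p n} → Prime p → Coprime k (p * n) ⇔ (Coprime k n × p ∤ k)
coprime-*-prime⇔ {k} {p} {n} pp = mk⇔ to from
  where
  to : Coprime k (p * n) → Coprime k n × p ∤ k
  to c = let (ckp , ckn) = Equivalence.to coprime-*⇔ c in ckn , Equivalence.to (coprime-prime⇔∤ pp) ckp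
  from : Coprime k n × p ∤ k → Coprime k (p * n)
  from (ckn , p∤k) = Equivalence.from coprime-*⇔ (Equivalence.from (coprime-prime⇔∤ pp) p∤k , ckn)

-- The totient of products and prime powers

coprimeTo : ℕ → ℕ → Bool
coprimeTo n k = does (coprime? k n)

φ≡count : ∀ n → φ n ≡ count (coprimeTo n ∘ suc) n
φ≡count n = begin
    length (filter gcd≟1 (map suc (upTo n)))
  ≡⟨ cong (length ∘ filter gcd≟1) (map-upTo suc n) ⟩
    length (filter gcd≟1 (applyUpTo suc n))
  ≡⟨ length-filter-applyUpTo gcd≟1 suc n ⟩
    count (λ k → does (gcd≟1 (suc k))) n
  ≡⟨ count-cong n (λ k → does-⇔ (mk⇔ gcd≡1⇒coprime coprime⇒gcd≡1) (gcd≟1 (suc k)) (coprime? (suc k) n)) ⟩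
    count (coprimeTo n ∘ suc) n ∎
  where
  open ≡-Reasoning
  gcd≟1 = λ k → gcd k n ≟ 1

coprimeTo-cong : ∀ {n n′ k k′} → Coprime k n ⇔ Coprime k′ n′ → coprimeTo n k ≡ coprimeTo n′ k′
coprimeTo-cong {n} {n′} {k} {k′} iff = does-⇔ iff (coprime? k n) (coprime? k′ n′)

count-coprimeTo-* : ∀ n i → count (coprimeTo n ∘ suc) (i * n) ≡ i * φ n
count-coprimeTo-* n i = begin
    count (coprimeTo n ∘ suc) (i * n)
  ≡⟨ count-periodic _ n (λ k → coprimeTo-cong (subst (λ x → Coprime x n ⇔ Coprime (suc k) n) (+-suc n k) coprime-+ˡ⇔)) i ⟩
    i * count (coprimeTo n ∘ suc) n
  ≡⟨ cong (i *_) (φ≡count n) ⟨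
    i * φ n ∎
  where open ≡-Reasoning

φ[p*n]≡p*φ[n] : ∀ {p n} → Prime p → p ∣ n → φ (p * n) ≡ p * φ n
φ[p*n]≡p*φ[n] {p} {n} pp p∣n = begin
    φ (p * n)
  ≡⟨ φ≡count (p * n) ⟩
    count (coprimeTo (p * n) ∘ suc) (p * n)
  ≡⟨ count-cong (p * n) (λ k → coprimeTo-cong (coprime-*⇔coprime {suc k})) ⟩
    count (coprimeTo n ∘ suc) (p * n)
  ≡⟨ count-coprimeTo-* n p ⟩
    p * φ n ∎
  where
  open ≡-Reasoning
  coprime⇒∤ : ∀ {k} → Coprime k n → p ∤ k
  coprime⇒∤ c p∣k = ¬prime[1] (subst Prime (c (p∣k , p∣n)) pp)
  coprime-*⇔coprime : ∀ {k} → Coprime k (p * n) ⇔ Coprime k n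
  coprime-*⇔coprime = mk⇔ (proj₁ ∘ Equivalence.to (coprime-*-prime⇔ pp))
                            (λ c → Equivalence.from (coprime-*-prime⇔ pp) (c , coprime⇒∤ c))

-- Of the p·φ(n) numbers in 1, …, pn coprime to n, those prime to p are counted by φ(pn)
-- and the multiples p·j (j ≤ n, j coprime to n) by φ(n).
φ[p*n]+φ[n]≡p*φ[n] : ∀ {p n} → Prime p → p ∤ n → φ (p * n) + φ n ≡ p * φ n
φ[p*n]+φ[n]≡p*φ[n] {suc q} {n} pp p∤n = begin
    φ (p * n) + φ n
  ≡⟨ cong₂ _+_ (sym (trans (φ≡count (p * n)) (count-cong (p * n) coprime-unless-multiple))) multiples ⟨
    count (λ k → f k ∧ not (g k)) (p * n) + count (λ k → f k ∧ g k) (p * n)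
  ≡⟨ +-comm (count (λ k → f k ∧ not (g k)) (p * n)) _ ⟩
    count (λ k → f k ∧ g k) (p * n) + count (λ k → f k ∧ not (g k)) (p * n)
  ≡⟨ count-split f g (p * n) ⟨
    count f (p * n)
  ≡⟨ count-coprimeTo-* n p ⟩
    p * φ n ∎
  where
  open ≡-Reasoning
  p = suc q
  f g : ℕ → Bool
  f = coprimeTo n ∘ suc
  g k = does (p ∣? suc k)
  coprime-unless-multiple : ∀ k → coprimeTo (p * n) (suc k) ≡ f k ∧ not (g k)
  coprime-unless-multiple k =
    does-⇔ (coprime-*-prime⇔ pp) (coprime? (suc k) (p * n)) (coprime? (suc k) n ×-dec ¬? (p ∣? suc k))
  multiples : count (λ k → f k ∧ g k) (p * n) ≡ φ n
  multiples = begin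
      count (λ k → f k ∧ g k) (p * n)
    ≡⟨ count-cong (p * n) (λ k → ∧-comm (f k) (g k)) ⟩
      count (onMultiples q (coprimeTo n)) (p * n)
    ≡⟨ count-onMultiples q (coprimeTo n) n ⟩
      count (λ j → coprimeTo n (p * suc j)) n
    ≡⟨ count-cong n (λ j → coprimeTo-cong (coprime-*ˡ⇔ {j = suc j} pp p∤n)) ⟩
      count f n
    ≡⟨ φ≡count n ⟨
      φ n ∎

φ[p*n]≡[p∸1]*φ[n] : ∀ {p n} → Prime p → p ∤ n → φ (p * n) ≡ (p ∸ 1) * φ n
φ[p*n]≡[p∸1]*φ[n] {p} {n} pp p∤n = begin
    φ (p * n)
  ≡⟨ m+n∸n≡m (φ (p * n)) (φ n) ⟨
    φ (p * n) + φ n ∸ φ n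
  ≡⟨ cong₂ _∸_ (φ[p*n]+φ[n]≡p*φ[n] pp p∤n) (sym (*-identityˡ (φ n))) ⟩
    p * φ n ∸ 1 * φ n
  ≡⟨ *-distribʳ-∸ (φ n) p 1 ⟨
    (p ∸ 1) * φ n ∎
  where open ≡-Reasoning

φ[p^[1+a]*w] : ∀ {p w} → Prime p → p ∤ w → ∀ a → φ (p ^ suc a * w) ≡ p ^ a * (p ∸ 1) * φ w
φ[p^[1+a]*w] {p} {w} pp p∤w zero = begin
    φ (p * 1 * w)
  ≡⟨ cong (λ x → φ (x * w)) (*-identityʳ p) ⟩
    φ (p * w)
  ≡⟨ φ[p*n]≡[p∸1]*φ[n] pp p∤w ⟩
    (p ∸ 1) * φ w
  ≡⟨ cong (_* φ w) (*-identityˡ (p ∸ 1)) ⟨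
    1 * (p ∸ 1) * φ w ∎
  where open ≡-Reasoning
φ[p^[1+a]*w] {p} {w} pp p∤w (suc a) = begin
    φ (p * p ^ suc a * w)
  ≡⟨ cong φ (*-assoc p (p ^ suc a) w) ⟩
    φ (p * (p ^ suc a * w))
  ≡⟨ φ[p*n]≡p*φ[n] pp (∣m⇒∣m*n w (∣m⇒∣m*n (p ^ a) ∣-refl)) ⟩
    p * φ (p ^ suc a * w)
  ≡⟨ cong (p *_) (φ[p^[1+a]*w] pp p∤w a) ⟩
    p * (p ^ a * (p ∸ 1) * φ w)
  ≡⟨ reassoc p (p ^ a) (p ∸ 1) (φ w) ⟩
    p * p ^ a * (p ∸ 1) * φ w ∎
  where
  open ≡-Reasoning
  reassoc : ∀ x y z u → x * (y * z * u) ≡ x * y * z * u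
  reassoc = solve-∀

φ[p^[1+a]] : ∀ {p} → Prime p → ∀ a → φ (p ^ suc a) ≡ p ^ a * (p ∸ 1)
φ[p^[1+a]] {p} pp a = begin
    φ (p ^ suc a)
  ≡⟨ cong φ (*-identityʳ (p ^ suc a)) ⟨
    φ (p ^ suc a * 1)
  ≡⟨ φ[p^[1+a]*w] pp (prime∤1 pp) a ⟩
    p ^ a * (p ∸ 1) * 1
  ≡⟨ *-identityʳ _ ⟩
    p ^ a * (p ∸ 1) ∎
  where open ≡-Reasoning

φ[p^[1+a]*w]≡φ[p^[1+a]]*φ[w] : ∀ {p w} → Prime p → p ∤ w → ∀ a → φ (p ^ suc a * w) ≡ φ (p ^ suc a) * φ w
φ[p^[1+a]*w]≡φ[p^[1+a]]*φ[w] {w = w} pp p∤w a =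
  trans (φ[p^[1+a]*w] pp p∤w a) (cong (_* φ w) (sym (φ[p^[1+a]] pp a)))

2∣φ[p^[1+a]] : ∀ {p} → Prime p → 2 ∤ p → ∀ a → 2 ∣ φ (p ^ suc a)
2∣φ[p^[1+a]] {p} pp 2∤p a = subst (2 ∣_) (sym (φ[p^[1+a]] pp a)) (∣n⇒∣m*n (p ^ a) (odd⇒2∣pred 2∤p))

φ[2^[1+a]*z] : ∀ {z} → 2 ∤ z → ∀ a → φ (2 ^ suc a * z) ≡ 2 ^ a * φ z
φ[2^[1+a]*z] {z} 2∤z a = trans (φ[p^[1+a]*w] prime[2] 2∤z a) (cong (_* φ z) (*-identityʳ (2 ^ a)))

φ[1*n] : ∀ n → φ (1 * n) ≡ φ n
φ[1*n] n = cong φ (*-identityˡ n)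

φ[2*odd] : ∀ {z} → 2 ∤ z → φ (2 * z) ≡ φ z
φ[2*odd] {z} 2∤z = trans (φ[2^[1+a]*z] 2∤z 0) (*-identityˡ (φ z))

φ-pos : ∀ {n} → 1 ≤ n → 1 ≤ φ n
φ-pos {suc t} _ rewrite φ≡count (suc t) | dec-true (coprime? 1 (suc t)) (Coprime.1-coprimeTo (suc t)) = s≤s z≤n

φ<n : ∀ n → 2 ≤ φ n → φ n < n
φ<n 1 (s≤s ())
φ<n (suc (suc t)) _ = begin-strict
    φ n
  ≡⟨ φ≡count n ⟩
    count f (suc (suc t))
  ≡⟨ count-last f (suc t) ⟩
    count f (suc t) + fromBool (f (suc t))
  ≡⟨ cong (λ b → count f (suc t) + fromBool b) (dec-false (coprime? n n) (λ c → contradiction (c (∣-refl , ∣-refl)) λ ())) ⟩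
    count f (suc t) + 0
  ≡⟨ +-identityʳ _ ⟩
    count f (suc t)
  ≤⟨ count-≤ f (suc t) ⟩
    suc t
  <⟨ n<1+n (suc t) ⟩
    n ∎
  where
  open ≤-Reasoning
  n = suc (suc t)
  f = coprimeTo n ∘ suc

-- Odd parts and odd prime factors

data TwoAdic : ℕ → Set where
  twoAdic : ∀ e z → 2 ∤ z → TwoAdic (2 ^ e * z)

twoAdic? : ∀ {n} → 1 ≤ n → TwoAdic n
twoAdic? 1≤n with p-adic-split {2} (s≤s (s≤s z≤n)) 1≤n
... | e , z , refl , 2∤z = twoAdic e z 2∤z

data OddPrimeSplit : ℕ → Set where
  oddPrimeSplit : ∀ {p} a w → Prime p → 2 ∤ p → p ∤ w → 2 ∤ w → OddPrimeSplit (p ^ suc a * w)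

oddPrimeSplit? : ∀ {n} → 2 ∤ n → n ≡ 1 ⊎ OddPrimeSplit n
oddPrimeSplit? {zero} 2∤0 = contradiction (divides 0 refl) 2∤0
oddPrimeSplit? {suc zero} _ = inj₁ refl
oddPrimeSplit? {n@(suc (suc _))} 2∤n with prime-divisor {n} (s≤s (s≤s z≤n))
... | p , pp , p∣n with p-adic-split (prime⇒2≤ pp) {n} (s≤s z≤n)
...   | zero , w , n≡1*w , p∤w = contradiction (subst (p ∣_) (trans n≡1*w (*-identityˡ w)) p∣n) p∤w
...   | suc a , w , n≡p^[1+a]*w , p∤w = inj₂ (subst OddPrimeSplit (sym n≡p^[1+a]*w)
          (oddPrimeSplit a w pp (λ 2∣p → 2∤n (∣-trans 2∣p p∣n)) p∤w
             (λ 2∣w → 2∤n (subst (2 ∣_) (sym n≡p^[1+a]*w) (∣n⇒∣m*n (p ^ suc a) 2∣w)))))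

odd⇒≡1⊎2∣φ : ∀ {n} → 2 ∤ n → n ≡ 1 ⊎ 2 ∣ φ n
odd⇒≡1⊎2∣φ 2∤n with oddPrimeSplit? 2∤n
... | inj₁ n≡1 = inj₁ n≡1
... | inj₂ (oddPrimeSplit a w pp 2∤p p∤w _) = inj₂
  (subst (2 ∣_) (sym (φ[p^[1+a]*w]≡φ[p^[1+a]]*φ[w] pp p∤w a)) (∣m⇒∣m*n (φ w) (2∣φ[p^[1+a]] pp 2∤p a)))

data OddPrimePower : ℕ → Set where
  oddPrimePower : ∀ {p} a → Prime p → 2 ∤ p → OddPrimePower (p ^ suc a)

odd∧4∤φ⇒≡1⊎primePower : ∀ {n} → 2 ∤ n → 4 ∤ φ n → n ≡ 1 ⊎ OddPrimePower n
odd∧4∤φ⇒≡1⊎primePower 2∤n 4∤φn with oddPrimeSplit? 2∤n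
... | inj₁ n≡1 = inj₁ n≡1
... | inj₂ (oddPrimeSplit {p} a w pp 2∤p p∤w 2∤w) with odd⇒≡1⊎2∣φ 2∤w
...   | inj₁ refl = inj₂ (subst OddPrimePower (sym (*-identityʳ (p ^ suc a))) (oddPrimePower a pp 2∤p))
...   | inj₂ 2∣φw = contradiction
  (subst (4 ∣_) (sym (φ[p^[1+a]*w]≡φ[p^[1+a]]*φ[w] pp p∤w a)) (*-pres-∣ (2∣φ[p^[1+a]] pp 2∤p a) 2∣φw)) 4∤φn

-- Upper bounds for n / φ(n)

m*[1+n]≤[1+m]*n : ∀ {m n} → m ≤ n → m * suc n ≤ suc m * n
m*[1+n]≤[1+m]*n {m} {n} m≤n = begin
    m * suc n
  ≡⟨ *-suc m n ⟩
    m + m * n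
  ≤⟨ +-monoˡ-≤ (m * n) m≤n ⟩
    n + m * n ∎
  where open ≤-Reasoning

prime-power-bound : ∀ m {p} → Prime p → suc m ≤ p → ∀ a → m * p ^ suc a ≤ suc m * φ (p ^ suc a)
prime-power-bound m {suc n} pp (s≤s m≤n) a = begin
    m * (p * p ^ a)
  ≡⟨ lhs m p (p ^ a) ⟩
    p ^ a * (m * p)
  ≤⟨ *-monoʳ-≤ (p ^ a) (m*[1+n]≤[1+m]*n m≤n) ⟩
    p ^ a * (suc m * n)
  ≡⟨ rhs (suc m) (p ^ a) n ⟩
    suc m * (p ^ a * n)
  ≡⟨ cong (suc m *_) (φ[p^[1+a]] pp a) ⟨
    suc m * φ (p ^ suc a) ∎
  where
  open ≤-Reasoning
  p = suc n
  lhs : ∀ k p x → k * (p * x) ≡ x * (k * p)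
  lhs = solve-∀
  rhs : ∀ l x q → x * (l * q) ≡ l * (x * q)
  rhs = solve-∀

*-mono-ratio : ∀ a b c d x y u v → a * x ≤ b * y → c * u ≤ d * v → (a * c) * (x * u) ≤ (b * d) * (y * v)
*-mono-ratio a b c d x y u v ax≤by cu≤dv = begin
    (a * c) * (x * u)
  ≡⟨ interchange a c x u ⟩
    (a * x) * (c * u)
  ≤⟨ *-mono-≤ ax≤by cu≤dv ⟩
    (b * y) * (d * v)
  ≡⟨ interchange b d y v ⟨
    (b * d) * (y * v) ∎
  where
  open ≤-Reasoning
  interchange : ∀ a c x u → (a * c) * (x * u) ≡ (a * x) * (c * u)
  interchange = solve-∀

odd∧4∤φ⇒2n≤3φ : ∀ {n} → 2 ∤ n → 4 ∤ φ n → 2 * n ≤ 3 * φ n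
odd∧4∤φ⇒2n≤3φ 2∤n 4∤φn with odd∧4∤φ⇒≡1⊎primePower 2∤n 4∤φn
... | inj₁ refl = s≤s (s≤s z≤n)
... | inj₂ (oddPrimePower a pp 2∤p) = prime-power-bound 2 pp (odd-prime⇒3≤ pp 2∤p) a

odd∧3∤∧4∤φ⇒4n≤5φ : ∀ {n} → 2 ∤ n → 3 ∤ n → 4 ∤ φ n → 4 * n ≤ 5 * φ n
odd∧3∤∧4∤φ⇒4n≤5φ 2∤n 3∤n 4∤φn with odd∧4∤φ⇒≡1⊎primePower 2∤n 4∤φn
... | inj₁ refl = s≤s (s≤s (s≤s (s≤s z≤n)))
... | inj₂ (oddPrimePower a pp 2∤p) =
  prime-power-bound 4 pp (odd-prime≢3⇒5≤ pp 2∤p λ { refl → 3∤n (∣m⇒∣m*n (3 ^ a) ∣-refl) }) a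

-- The factor 15/8 = (3/2)(5/4) comes from two distinct odd primes, one of which is at least 5.
odd∧8∤φ⇒8n≤15φ : ∀ {n} → 2 ∤ n → 8 ∤ φ n → 8 * n ≤ 15 * φ n
odd∧8∤φ⇒8n≤15φ 2∤n 8∤φn with oddPrimeSplit? 2∤n
... | inj₁ refl = s≤s (s≤s (s≤s (s≤s (s≤s (s≤s (s≤s (s≤s z≤n)))))))
... | inj₂ (oddPrimeSplit {p} a w pp 2∤p p∤w 2∤w) =
  subst (λ x → 8 * (p ^ suc a * w) ≤ 15 * x) (sym φ-mult) bound
  where
  φ-mult = φ[p^[1+a]*w]≡φ[p^[1+a]]*φ[w] pp p∤w a
  4∤φw : 4 ∤ φ w
  4∤φw 4∣φw = 8∤φn (subst (8 ∣_) (sym φ-mult) (*-pres-∣ (2∣φ[p^[1+a]] pp 2∤p a) 4∣φw))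
  P = p ^ suc a
  bound : 8 * (P * w) ≤ 15 * (φ P * φ w)
  bound with p ≟ 3
  ... | yes refl = *-mono-ratio 2 3 4 5 P (φ P) w (φ w) (prime-power-bound 2 pp (odd-prime⇒3≤ pp 2∤p) a)
                                        (odd∧3∤∧4∤φ⇒4n≤5φ 2∤w p∤w 4∤φw)
  ... | no p≢3 = *-mono-ratio 4 5 2 3 P (φ P) w (φ w) (prime-power-bound 4 pp (odd-prime≢3⇒5≤ pp 2∤p p≢3) a)
                                      (odd∧4∤φ⇒2n≤3φ 2∤w 4∤φw)

odd∧8∤φ⇒n<2φ : ∀ {n} → 2 ∤ n → 8 ∤ φ n → n < 2 * φ n
odd∧8∤φ⇒n<2φ {n} 2∤n 8∤φn = *-cancelˡ-< 8 n (2 * φ n) (begin-strict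
    8 * n
  ≤⟨ odd∧8∤φ⇒8n≤15φ 2∤n 8∤φn ⟩
    15 * φ n
  <⟨ m<m+n (15 * φ n) (φ-pos (odd⇒1≤ 2∤n)) ⟩
    15 * φ n + φ n
  ≡⟨ sixteen (φ n) ⟩
    8 * (2 * φ n) ∎)
  where
  open ≤-Reasoning
  sixteen : ∀ x → 15 * x + x ≡ 8 * (2 * x)
  sixteen = solve-∀

φ-odd-part-∣ : ∀ {z} → 2 ∤ z → ∀ e → φ z ∣ φ (2 ^ e * z)
φ-odd-part-∣ {z} 2∤z zero = subst (φ z ∣_) (sym (φ[1*n] z)) ∣-refl
φ-odd-part-∣ {z} 2∤z (suc a) = subst (φ z ∣_) (sym (φ[2^[1+a]*z] 2∤z a)) (∣n⇒∣m*n (2 ^ a) ∣-refl)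

8∤φ⇒n<4φ : ∀ {n} → 1 ≤ n → 8 ∤ φ n → n < 4 * φ n
8∤φ⇒n<4φ 1≤n 8∤φn with twoAdic? 1≤n
... | twoAdic e z 2∤z = from-odd-part e (odd∧8∤φ⇒n<2φ 2∤z (λ 8∣φz → 8∤φn (∣-trans 8∣φz (φ-odd-part-∣ 2∤z e))))
  where
  from-odd-part : ∀ e → z < 2 * φ z → 2 ^ e * z < 4 * φ (2 ^ e * z)
  from-odd-part zero z<2φz =
    subst₂ (λ x y → x < 4 * y) (sym (*-identityˡ z)) (sym (φ[1*n] z))
      (<-≤-trans z<2φz (*-monoˡ-≤ (φ z) {2} {4} (s≤s (s≤s z≤n))))
  from-odd-part (suc a) z<2φz =
    subst₂ _<_ (lhs (2 ^ a) z) (trans (rhs (2 ^ a) (φ z)) (cong (4 *_) (sym (φ[2^[1+a]*z] 2∤z a))))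
      (*-monoʳ-< (2 ^ a) {{m^n≢0 2 a}} (*-monoʳ-< 2 z<2φz))
    where
    lhs : ∀ x z → x * (2 * z) ≡ 2 * x * z
    lhs = solve-∀
    rhs : ∀ x f → x * (2 * (2 * f)) ≡ 4 * (x * f)
    rhs = solve-∀

4∤φ⇒n≤3φ : ∀ {n} → 1 ≤ n → 4 ∤ φ n → n ≤ 3 * φ n
4∤φ⇒n≤3φ 1≤n 4∤φn with twoAdic? 1≤n
... | twoAdic e z 2∤z = from-odd-part e (odd∧4∤φ⇒2n≤3φ 2∤z (λ 4∣φz → 4∤φn (∣-trans 4∣φz (φ-odd-part-∣ 2∤z e))))
  where
  from-odd-part : ∀ e → 2 * z ≤ 3 * φ z → 2 ^ e * z ≤ 3 * φ (2 ^ e * z)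
  from-odd-part zero 2z≤3φz =
    subst₂ (λ x y → x ≤ 3 * y) (sym (*-identityˡ z)) (sym (φ[1*n] z)) (≤-trans (m≤n*m z 2) 2z≤3φz)
  from-odd-part (suc a) 2z≤3φz =
    subst₂ _≤_ (lhs (2 ^ a) z) (trans (rhs (2 ^ a) (φ z)) (cong (3 *_) (sym (φ[2^[1+a]*z] 2∤z a))))
      (*-monoʳ-≤ (2 ^ a) 2z≤3φz)
    where
    lhs : ∀ x z → x * (2 * z) ≡ 2 * x * z
    lhs = solve-∀
    rhs : ∀ x f → x * (3 * f) ≡ 3 * (x * f)
    rhs = solve-∀

-- Odd preimages, and N₂(m), N₃(m) for 8 ∤ m

-- The witness is 3z when 3 ∤ z; otherwise z = 3^(a+1), and it is 5 (a = 0) or 7·3^a.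
odd-preimage-of-2φ : ∀ {z} → 2 ∤ z → 4 ∤ φ z → ∃ λ y → 2 ∤ y × φ y ≡ 2 * φ z
odd-preimage-of-2φ {z} 2∤z 4∤φz with 3 ∣? z
... | no 3∤z = 3 * z , odd-* (from-no (2 ∣? 3)) 2∤z , φ[p*n]≡[p∸1]*φ[n] prime[3] 3∤z
... | yes 3∣z with odd∧4∤φ⇒≡1⊎primePower 2∤z 4∤φz
...   | inj₁ refl = contradiction 3∣z (from-no (3 ∣? 1))
...   | inj₂ (oddPrimePower a pp 2∤p) with prime∣prime⇒≡ prime[3] pp (prime∣^⇒∣ (suc a) prime[3] 3∣z)
...     | refl = power-of-3 a
  where
  power-of-3 : ∀ a → ∃ λ y → 2 ∤ y × φ y ≡ 2 * φ (3 ^ suc a)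
  power-of-3 zero = 5 , from-no (2 ∣? 5) , refl
  power-of-3 (suc b) = 7 * 3 ^ suc b , odd-* (from-no (2 ∣? 7)) (2∤3^ (suc b)) , (begin
      φ (7 * 3 ^ suc b)
    ≡⟨ φ[p*n]≡[p∸1]*φ[n] prime[7] (λ 7∣3^ → from-no (7 ∣? 3) (prime∣^⇒∣ (suc b) prime[7] 7∣3^)) ⟩
      6 * φ (3 ^ suc b)
    ≡⟨ cong (6 *_) (φ[p^[1+a]] prime[3] b) ⟩
      6 * (3 ^ b * 2)
    ≡⟨ regroup (3 ^ b) ⟩
      2 * (3 ^ suc b * 2)
    ≡⟨ cong (2 *_) (φ[p^[1+a]] prime[3] (suc b)) ⟨
      2 * φ (3 ^ suc (suc b)) ∎)
    where
    open ≡-Reasoning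
    regroup : ∀ x → 6 * (x * 2) ≡ 2 * (3 * x * 2)
    regroup = solve-∀

8∣2^[3+a]*n : ∀ a n → 8 ∣ 2 ^ (3 + a) * n
8∣2^[3+a]*n a n = divides (2 ^ a * n) (regroup (2 ^ a) n)
  where
  regroup : ∀ x n → 2 * (2 * (2 * x)) * n ≡ x * n * 8
  regroup = solve-∀

odd-preimage-2^e : ∀ e {z} → 2 ∤ z → 8 ∤ φ (2 ^ e * z) → ∃ λ y → 2 ∤ y × φ y ≡ φ (2 ^ e * z)
odd-preimage-2^e zero {z} 2∤z _ = z , 2∤z , sym (φ[1*n] z)
odd-preimage-2^e 1 {z} 2∤z _ = z , 2∤z , sym (φ[2*odd] 2∤z)
odd-preimage-2^e 2 {z} 2∤z 8∤φx with odd-preimage-of-2φ 2∤z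
  (λ 4∣φz → 8∤φx (subst (8 ∣_) (sym (φ[2^[1+a]*z] 2∤z 1)) (*-pres-∣ (∣-refl {2}) 4∣φz)))
... | y , 2∤y , φy≡2φz = y , 2∤y , trans φy≡2φz (sym (φ[2^[1+a]*z] 2∤z 1))
odd-preimage-2^e 3 {z} 2∤z 8∤φx with odd⇒≡1⊎2∣φ 2∤z
... | inj₁ refl = 5 , from-no (2 ∣? 5) , refl
... | inj₂ 2∣φz = contradiction (subst (8 ∣_) (sym (φ[2^[1+a]*z] 2∤z 2)) (*-pres-∣ (∣-refl {4}) 2∣φz)) 8∤φx
odd-preimage-2^e (suc (suc (suc (suc a)))) {z} 2∤z 8∤φx =
  contradiction (subst (8 ∣_) (sym (φ[2^[1+a]*z] 2∤z (3 + a))) (8∣2^[3+a]*n a (φ z))) 8∤φx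

odd-preimage : ∀ {m} → InV m → 8 ∤ m → ∃ λ z → 2 ∤ z × φ z ≡ m
odd-preimage (x , 1≤x , refl) 8∤φx with twoAdic? 1≤x
... | twoAdic e z 2∤z = odd-preimage-2^e e 2∤z 8∤φx


φ[a]≡m⇒m<a : ∀ {m} a → 2 ≤ m → φ a ≡ m → m < a
φ[a]≡m⇒m<a a 2≤m refl = φ<n a 2≤m

N₃-bounds : ∀ {m a} → InV m → 2 ≤ m → 8 ∤ m → IsN₃ m a → m < a × a < 2 * m
N₃-bounds {a = a} m∈V 2≤m 8∤m (_ , φa≡m , minimal) with odd-preimage m∈V 8∤m
... | z , 2∤z , refl = φ[a]≡m⇒m<a a 2≤m φa≡m , ≤-<-trans (minimal z (odd⇒1≤ 2∤z) refl) (odd∧8∤φ⇒n<2φ 2∤z 8∤m)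

N₂[φ[odd]]≥2*odd : ∀ {z b} → 2 ∤ z → IsN₂ (φ z) b → 2 * z ≤ b
N₂[φ[odd]]≥2*odd {z} 2∤z (_ , _ , maximal) = maximal (2 * z) (≤-trans (odd⇒1≤ 2∤z) (m≤n*m z 2)) (φ[2*odd] 2∤z)

N₂-bounds : ∀ {m b} → InV m → 2 ≤ m → 8 ∤ m → IsN₂ m b → 2 * m < b × b < 4 * m
N₂-bounds {b = b} m∈V 2≤m 8∤m isN₂@(1≤b , φb≡m , _) with odd-preimage m∈V 8∤m
... | z , 2∤z , refl =
  <-≤-trans (*-monoʳ-< 2 (φ<n z 2≤m)) (N₂[φ[odd]]≥2*odd 2∤z isN₂) ,
  subst (λ x → b < 4 * x) φb≡m (8∤φ⇒n<4φ 1≤b (subst (8 ∤_) (sym φb≡m) 8∤m))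

4∤⇒8∤ : ∀ {m} → 4 ∤ m → 8 ∤ m
4∤⇒8∤ 4∤m 8∣m = 4∤m (∣-trans (divides 2 refl) 8∣m)

N₂/N₃-bounds : ∀ {m a b} → InV m → 2 ≤ m → 4 ∤ m → IsN₃ m a → IsN₂ m b → 2 * a ≤ b × b ≤ 3 * a
N₂/N₃-bounds {a = a} {b} m∈V 2≤m 4∤m (_ , φa≡m , minimal) isN₂@(1≤b , φb≡m , _)
  with odd-preimage m∈V (4∤⇒8∤ 4∤m)
... | z , 2∤z , refl =
  ≤-trans (*-monoʳ-≤ 2 (minimal z (odd⇒1≤ 2∤z) refl)) (N₂[φ[odd]]≥2*odd 2∤z isN₂) ,
  ≤-trans (subst (λ x → b ≤ 3 * x) φb≡m (4∤φ⇒n≤3φ 1≤b (subst (4 ∤_) (sym φb≡m) 4∤m)))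
          (*-monoʳ-≤ 3 (<⇒≤ (φ[a]≡m⇒m<a a 2≤m φa≡m)))

-- The preimages of 2·3^K

4∤2*3^ : ∀ K → 4 ∤ 2 * 3 ^ K
4∤2*3^ K 4∣2*3^K = 2∤3^ K (*-cancelˡ-∣ 2 4∣2*3^K)

φ[3^[1+K]] : ∀ K → φ (3 ^ suc K) ≡ 2 * 3 ^ K
φ[3^[1+K]] K = trans (φ[p^[1+a]] prime[3] K) (*-comm (3 ^ K) 2)

φ[2*3^[1+K]] : ∀ K → φ (2 * 3 ^ suc K) ≡ 2 * 3 ^ K
φ[2*3^[1+K]] K = trans (φ[2*odd] (2∤3^ (suc K))) (φ[3^[1+K]] K)

odd-prime∣2*3^⇒≡3 : ∀ {p} K → Prime p → 2 ∤ p → p ∣ 2 * 3 ^ K → p ≡ 3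
odd-prime∣2*3^⇒≡3 K pp 2∤p p∣2*3^K with euclidsLemma 2 (3 ^ K) pp p∣2*3^K
... | inj₁ p∣2 = contradiction (subst (2 ∣_) (sym (prime∣prime⇒≡ pp prime[2] p∣2)) ∣-refl) 2∤p
... | inj₂ p∣3^K = prime∣prime⇒≡ pp prime[3] (prime∣^⇒∣ K pp p∣3^K)

-- A prime power p^(a+1) with φ = 2·3^K has a = 0 and p = 2·3^K + 1, or p ∣ 2·3^K and so p = 3.
odd-φ≡2*3^K : ∀ K {z} → ¬ Prime (2 * 3 ^ K + 1) → 2 ∤ z → φ z ≡ 2 * 3 ^ K → z ≡ 3 ^ suc K
odd-φ≡2*3^K K ¬prime 2∤z φz≡ with odd∧4∤φ⇒≡1⊎primePower 2∤z (subst (4 ∤_) (sym φz≡) (4∤2*3^ K))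
... | inj₁ refl = contradiction (subst (2 ∣_) (sym φz≡) (divides (3 ^ K) (*-comm 2 (3 ^ K)))) (from-no (2 ∣? 1))
... | inj₂ (oddPrimePower {p} (suc a) pp 2∤p)
  with odd-prime∣2*3^⇒≡3 K pp 2∤p
         (subst (p ∣_) (trans (sym (φ[p^[1+a]] pp (suc a))) φz≡) (∣m⇒∣m*n (p ∸ 1) (∣m⇒∣m*n (p ^ a) ∣-refl)))
...   | refl = cong (3 *_) (*-cancelʳ-≡ (3 ^ suc a) (3 ^ K) 2 (trans (sym (φ[p^[1+a]] prime[3] (suc a))) (trans φz≡ (*-comm 2 (3 ^ K)))))
odd-φ≡2*3^K K ¬prime 2∤z φz≡ | inj₂ (oddPrimePower {p} zero pp _) = contradiction (subst Prime p≡ pp) ¬prime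
  where
  p≡ : p ≡ 2 * 3 ^ K + 1
  p≡ = begin
      p
    ≡⟨ m∸n+n≡m (≤-trans (s≤s z≤n) (prime⇒2≤ pp)) ⟨
      p ∸ 1 + 1
    ≡⟨ cong (_+ 1) (trans (sym (*-identityˡ (p ∸ 1))) (trans (sym (φ[p^[1+a]] pp 0)) φz≡)) ⟩
      2 * 3 ^ K + 1 ∎
    where open ≡-Reasoning

2^a*φ[odd]≢3^K : ∀ a K {z} → ¬ Prime (2 * 3 ^ K + 1) → 2 ∤ z → 2 ^ a * φ z ≢ 3 ^ K
2^a*φ[odd]≢3^K (suc a) K {z} _ _ eq = 2∤3^ K (subst (2 ∣_) eq (∣m⇒∣m*n (φ z) (∣m⇒∣m*n (2 ^ a) ∣-refl)))
2^a*φ[odd]≢3^K zero K {z} ¬prime 2∤z eq with odd⇒≡1⊎2∣φ 2∤z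
... | inj₂ 2∣φz = 2∤3^ K (subst (2 ∣_) (trans (sym (*-identityˡ (φ z))) eq) 2∣φz)
... | inj₁ refl with m^n≡1⇒n≡0∨m≡1 3 K (sym eq)
...   | inj₁ refl = ¬prime prime[3]
...   | inj₂ ()

preimage-of-2*3^K : ∀ e K {z} → ¬ Prime (2 * 3 ^ K + 1) → 2 ∤ z → φ (2 ^ e * z) ≡ 2 * 3 ^ K →
                    2 ^ e * z ≡ 3 ^ suc K ⊎ 2 ^ e * z ≡ 2 * 3 ^ suc K
preimage-of-2*3^K zero K {z} ¬prime 2∤z φ≡ =
  inj₁ (trans (*-identityˡ z) (odd-φ≡2*3^K K ¬prime 2∤z (trans (sym (φ[1*n] z)) φ≡)))
preimage-of-2*3^K 1 K ¬prime 2∤z φ≡ =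
  inj₂ (cong (2 *_) (odd-φ≡2*3^K K ¬prime 2∤z (trans (sym (φ[2*odd] 2∤z)) φ≡)))
preimage-of-2*3^K (suc (suc a)) K {z} ¬prime 2∤z φ≡ = contradiction
  (*-cancelˡ-≡ (2 ^ a * φ z) (3 ^ K) 2 (trans (sym (*-assoc 2 (2 ^ a) (φ z))) (trans (sym (φ[2^[1+a]*z] 2∤z (suc a))) φ≡)))
  (2^a*φ[odd]≢3^K a K ¬prime 2∤z)

φ⁻¹[2*3^K] : ∀ K {y} → ¬ Prime (2 * 3 ^ K + 1) → 1 ≤ y → φ y ≡ 2 * 3 ^ K → y ≡ 3 ^ suc K ⊎ y ≡ 2 * 3 ^ suc K
φ⁻¹[2*3^K] K ¬prime 1≤y φy≡ with twoAdic? 1≤y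
... | twoAdic e z 2∤z = preimage-of-2*3^K e K ¬prime 2∤z φy≡

N₃[2*3^K] : ∀ K → ¬ Prime (2 * 3 ^ K + 1) → IsN₃ (2 * 3 ^ K) (3 ^ suc K)
N₃[2*3^K] K ¬prime = 1≤3^ (suc K) , φ[3^[1+K]] K , minimal
  where
  minimal : ∀ y → 1 ≤ y → φ y ≡ 2 * 3 ^ K → 3 ^ suc K ≤ y
  minimal y 1≤y φy≡ with φ⁻¹[2*3^K] K ¬prime 1≤y φy≡
  ... | inj₁ refl = ≤-refl
  ... | inj₂ refl = m≤n*m (3 ^ suc K) 2

N₂[2*3^K] : ∀ K → ¬ Prime (2 * 3 ^ K + 1) → IsN₂ (2 * 3 ^ K) (2 * 3 ^ suc K)
N₂[2*3^K] K ¬prime = ≤-trans (1≤3^ (suc K)) (m≤n*m (3 ^ suc K) 2) , φ[2*3^[1+K]] K , maximal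
  where
  maximal : ∀ y → 1 ≤ y → φ y ≡ 2 * 3 ^ K → y ≤ 2 * 3 ^ suc K
  maximal y 1≤y φy≡ with φ⁻¹[2*3^K] K ¬prime 1≤y φy≡
  ... | inj₁ refl = m≤n*m (3 ^ suc K) 2
  ... | inj₂ refl = ≤-refl

n<m^n : ∀ {m} → 2 ≤ m → ∀ n → n < m ^ n
n<m^n 2≤m zero = s≤s z≤n
n<m^n {m} 2≤m (suc n) = begin-strict
    suc n
  ≤⟨ n<m^n 2≤m n ⟩
    m ^ n
  <⟨ m<m+n (m ^ n) (m^n>0 m {{>-nonZero (<-trans z<s 2≤m)}} n) ⟩
    m ^ n + m ^ n
  ≡⟨ cong (m ^ n +_) (+-identityʳ (m ^ n)) ⟨
    2 * m ^ n
  ≤⟨ *-monoˡ-≤ (m ^ n) 2≤m ⟩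
    m * m ^ n ∎
  where open ≤-Reasoning

-- 3^4 ≡ 1 (mod 5), so 2·3^(3+4j) + 1 ≡ 2·27 + 1 ≡ 0 (mod 5).
5∣2*3^[3+4j]+1 : ∀ j → 5 ∣ 2 * 3 ^ (3 + 4 * j) + 1
5∣2*3^[3+4j]+1 zero = divides 11 refl
5∣2*3^[3+4j]+1 (suc j) = subst (λ n → 5 ∣ 2 * 3 ^ n + 1) (cong (3 +_) (sym (*-suc 4 j)))
  (subst (5 ∣_) (sym (step (3 ^ (3 + 4 * j))))
     (∣m∣n⇒∣m+n (∣m⇒∣m*n (2 * 3 ^ (3 + 4 * j)) (divides 16 refl)) (5∣2*3^[3+4j]+1 j)))
  where
  step : ∀ x → 2 * (3 * (3 * (3 * (3 * x)))) + 1 ≡ 80 * (2 * x) + (2 * x + 1)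
  step = solve-∀

¬prime[2*3^[3+4j]+1] : ∀ j → ¬ Prime (2 * 3 ^ (3 + 4 * j) + 1)
¬prime[2*3^[3+4j]+1] j = composite⇒¬prime (composite 5<n (5∣2*3^[3+4j]+1 j))
  where
  5<n : 5 < 2 * 3 ^ (3 + 4 * j) + 1
  5<n = ≤-trans (*-monoʳ-≤ 2 (^-monoʳ-≤ 3 {1} {3 + 4 * j} (s≤s z≤n))) (m≤m+n _ 1)

3^[4+4j]≡81*81^j : ∀ j → 3 ^ (4 + 4 * j) ≡ 81 * 81 ^ j
3^[4+4j]≡81*81^j j = trans (cong (λ x → 3 * (3 * (3 * (3 * x)))) (sym (^-*-assoc 3 4 j))) (regroup (81 ^ j))
  where
  regroup : ∀ x → 3 * (3 * (3 * (3 * x))) ≡ 81 * x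
  regroup = solve-∀

2*3^K∈V : ∀ K → InV (2 * 3 ^ K)
2*3^K∈V K = 3 ^ suc K , 1≤3^ (suc K) , φ[3^[1+K]] K

N₃[2*3^[3+4j]] : ∀ j → IsN₃ (2 * 3 ^ (3 + 4 * j)) (81 * 81 ^ j)
N₃[2*3^[3+4j]] j = subst (IsN₃ _) (3^[4+4j]≡81*81^j j) (N₃[2*3^K] (3 + 4 * j) (¬prime[2*3^[3+4j]+1] j))

N₂[2*3^[3+4j]] : ∀ j → IsN₂ (2 * 3 ^ (3 + 4 * j)) (162 * 81 ^ j)
N₂[2*3^[3+4j]] j = subst (IsN₂ _) (trans (cong (2 *_) (3^[4+4j]≡81*81^j j)) (sym (*-assoc 2 81 (81 ^ j))))
                         (N₂[2*3^K] (3 + 4 * j) (¬prime[2*3^[3+4j]+1] j))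

j≤2*3^[3+4j] : ∀ j → j ≤ 2 * 3 ^ (3 + 4 * j)
j≤2*3^[3+4j] j = begin
    j
  ≤⟨ m≤n*m j 4 ⟩
    4 * j
  ≤⟨ m≤n+m (4 * j) 3 ⟩
    3 + 4 * j
  <⟨ n<m^n (s≤s (s≤s z≤n)) (3 + 4 * j) ⟩
    3 ^ (3 + 4 * j)
  ≤⟨ m≤n*m (3 ^ (3 + 4 * j)) 2 ⟩
    2 * 3 ^ (3 + 4 * j) ∎
  where open ≤-Reasoning

%≡1+r⇒∤ : ∀ m n {r} .{{_ : NonZero n}} → m % n ≡ suc r → n ∤ m
%≡1+r⇒∤ m n m%n≡1+r n∣m = 0≢1+n (trans (sym (n∣m⇒m%n≡0 m n n∣m)) m%n≡1+r)

%≡⇒≤ : ∀ m n {r} .{{_ : NonZero n}} → m % n ≡ r → r ≤ m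
%≡⇒≤ m n m%n≡r = subst (_≤ m) m%n≡r (m%n≤m m n)

%4≡2⊎%8≡4⇒2≤∧8∤ : ∀ m → m % 4 ≡ 2 ⊎ m % 8 ≡ 4 → 2 ≤ m × 8 ∤ m
%4≡2⊎%8≡4⇒2≤∧8∤ m (inj₁ m%4≡2) = %≡⇒≤ m 4 m%4≡2 , 4∤⇒8∤ (%≡1+r⇒∤ m 4 m%4≡2)
%4≡2⊎%8≡4⇒2≤∧8∤ m (inj₂ m%8≡4) = ≤-trans (s≤s (s≤s z≤n)) (%≡⇒≤ m 8 m%8≡4) , %≡1+r⇒∤ m 8 m%8≡4

theorem1p6 : ((m : ℕ) → InV m → (m % 4 ≡ 2 ⊎ m % 8 ≡ 4) →
    (∀ a → IsN₃ m a → m < a × a < 2 * m) ×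
    (∀ b → IsN₂ m b → 2 * m < b × b < 4 * m))
    ×
    ((∀ k → ∃ λ m → k ≤ m × InV m × ∃ λ b → ∃ λ a → IsN₂ m b × IsN₃ m a × b ≡ 2 * a)
      ×
     ((m : ℕ) → InV m → m % 4 ≡ 2 → ∀ a b → IsN₃ m a → IsN₂ m b → 2 * a ≤ b × b ≤ 3 * a))
    ×
    ((∃ λ c → ∃ λ r → 1 ≤ c × 2 ≤ r × (∀ k → InN₂ (c * r ^ k)))
      ×
     (∃ λ c → ∃ λ r → 1 ≤ c × 2 ≤ r × (∀ k → InN₃ (c * r ^ k))))
theorem1p6 =
  (λ m m∈V residue → let (2≤m , 8∤m) = %4≡2⊎%8≡4⇒2≤∧8∤ m residue in
     (λ _ → N₃-bounds m∈V 2≤m 8∤m) , (λ _ → N₂-bounds m∈V 2≤m 8∤m)) ,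
  ((λ j → 2 * 3 ^ (3 + 4 * j) , j≤2*3^[3+4j] j , 2*3^K∈V (3 + 4 * j) ,
          162 * 81 ^ j , 81 * 81 ^ j , N₂[2*3^[3+4j]] j , N₃[2*3^[3+4j]] j , *-assoc 2 81 (81 ^ j)) ,
   (λ m m∈V m%4≡2 _ _ → N₂/N₃-bounds m∈V (%≡⇒≤ m 4 m%4≡2) (%≡1+r⇒∤ m 4 m%4≡2))) ,
  (162 , 81 , s≤s z≤n , s≤s (s≤s z≤n) , λ j → 2 * 3 ^ (3 + 4 * j) , 2*3^K∈V (3 + 4 * j) , N₂[2*3^[3+4j]] j) ,
  (81 , 81 , s≤s z≤n , s≤s (s≤s z≤n) , λ j → 2 * 3 ^ (3 + 4 * j) , 2*3^K∈V (3 + 4 * j) , N₃[2*3^[3+4j]] j)
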